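{- For $n\ge 0$, let $\mathrm{bsm}_n$ be the number of (complete) matchings $M$ of $[2n]=\{1,\dots,2n\}$ that are bilaterally symmetric, i.e. such that $\{i,j\}$ is a block of $M$ if and only if $\{2n+1-j,2n+1-i\}$ is a block of $M$. Then $$\sum_{n\ge 0}\mathrm{bsm}_n\frac{t^n}{n!}=\exp(t+t^2).$$
   Context: A (complete) matching of $[2n]$ is a partition of $[2n]$ into $n$ blocks of size two. -}

module Defs where

open import Data.Nat using (ℕ; zero; suc; _∸_; _!; _*_)
open import Data.Nat.Properties using (_!≢0)
open import Data.Fin using (Fin; opposite)
open import Data.Fin.Properties using (all?; _≟_)
open import Data.Vec using (Vec; []; _∷_; lookup)
open import Data.List using (List; []; _∷_; concatMap; map; filter; length)
open import Data.Fin using () renaming (zero to fzero)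
open import Data.List using (allFin) renaming ()
open import Data.Product using (_×_)
open import Data.Product.Properties using ()
open import Relation.Nullary using (¬_; Dec)
open import Relation.Nullary.Decidable using (_×-dec_; ¬?)
open import Relation.Binary.PropositionalEquality using (_≡_)
open import Data.Integer using (+_)
open import Data.Rational using (ℚ; 0ℚ; 1ℚ; _/_) renaming (_+_ to _+ℚ_; _*_ to _*ℚ_)

-- A complete matching M of a finite set X (partition into blocks of
-- size two) is the same datum as the map σ sending each point to the
-- other element of its block: σ is a fixed-point-free involution, and
-- the blocks are {i, σ i}.

allVecs : (m k : ℕ) → List (Vec (Fin m) k)
allVecs m zero    = [] ∷ []
allVecs m (suc k) = concatMap (λ i → map (i ∷_) (allVecs m k)) (allFin m)

IsMatching : ∀ {m} → Vec (Fin m) m → Set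
IsMatching σ = ∀ i → (lookup σ (lookup σ i) ≡ i) × ¬ (lookup σ i ≡ i)

-- Bilateral symmetry: {i,j} block ⇔ {r j, r i} block, where
-- r = opposite is i ↦ 2n+1-i (in 1-based labelling).  In terms of
-- the partner map: σ (r i) = r (σ i) for all i.
IsBilSym : ∀ {m} → Vec (Fin m) m → Set
IsBilSym σ = ∀ i → lookup σ (opposite i) ≡ opposite (lookup σ i)

isBSM? : ∀ {m} (σ : Vec (Fin m) m) → Dec (IsMatching σ × IsBilSym σ)
isBSM? σ =
  all? (λ i → (lookup σ (lookup σ i) ≟ i) ×-dec ¬? (lookup σ i ≟ i))
  ×-dec all? (λ i → lookup σ (opposite i) ≟ opposite (lookup σ i))

bsm : ℕ → ℕ
bsm n = length (filter isBSM? (allVecs (2 * n) (2 * n)))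

PS : Set
PS = ℕ → ℚ

sumTo : ℕ → (ℕ → ℚ) → ℚ
sumTo zero    f = f 0
sumTo (suc n) f = sumTo n f +ℚ f (suc n)

onePS : PS
onePS zero    = 1ℚ
onePS (suc _) = 0ℚ

_⊛_ : PS → PS → PS
(f ⊛ g) n = sumTo n (λ i → f i *ℚ g (n ∸ i))

_^PS_ : PS → ℕ → PS
f ^PS zero  = onePS
f ^PS suc k = f ⊛ (f ^PS k)

-- exp f = Σ_{k≥0} f^k / k!, for f with zero constant term.
-- Then f^k has no terms below t^k, so the coefficient of t^n is the
-- finite sum Σ_{k=0}^{n} [t^n] f^k / k!.
expPS : PS → PS
expPS f n = sumTo n (λ k → ((+ 1) / (k !)) {{k !≢0}} *ℚ (f ^PS k) n)

t+t² : PS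
t+t² 1 = 1ℚ
t+t² 2 = 1ℚ
t+t² _ = 0ℚ

-- t+t² has zero constant term, so expPS applies
t+t²-const : t+t² 0 ≡ 0ℚ
t+t²-const = _≡_.refl

{-# OPTIONS --safe #-}
module Submission where

-- Let y be the partner of the first point in a bilaterally symmetric matching of [2n+4]; by symmetry
-- the last point is matched with the mirror image y′ of y. If y is the last point, deleting the block
-- {1, 2n+4} leaves a bilaterally symmetric matching of [2n+2]. Otherwise y is one of the 2n+2 inner
-- points, and deleting 1 and 2n+4 while joining y with y′ is a bijection onto the bilaterally symmetric
-- matchings of [2n+2] containing the block {y, y′}; conjugating by an involution that commutes with the
-- reflection moves this block to {1, 2n+2}, so there are bsm_n of them. Hence
-- bsm_(n+2) = (2n+2) bsm_n + bsm_(n+1). As exp(t+t²)′ = (1+2t) exp(t+t²), the numbers n! [t^n] exp(t+t²)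
-- obey the same recurrence; this is checked on the summands n!/k! [t^n] (t+t²)^k.

module Counting where

  open import Level using (0ℓ)
  open import Data.Nat using (ℕ; zero; suc; _+_; _*_; _≤_)
  open import Data.Nat.Properties using (≤-antisym; +-0-commutativeMonoid)
  open import Data.Fin using (Fin; zero; suc; punchIn)
  open import Data.Fin.Properties using (injective⇒≤; punchInᵢ≢i) renaming (_≟_ to _≟ᶠ_)
  open import Data.Vec using (Vec; []; _∷_; lookup; tabulate)
  open import Data.Vec.Properties using (lookup∘tabulate; tabulate∘lookup; tabulate-cong; ∷-injective)
  open import Data.Vec.Functional using (removeAt)
  open import Data.List using (List; []; _∷_; length; filter; map)
  import Data.List as List
  open import Data.List.Membership.Propositional using (_∈_)
  open import Data.List.Membership.Propositional.Properties
    using (∈-filter⁺; ∈-filter⁻; ∈-lookup; ∈-map⁺; ∈-map⁻; ∈-allFin; ∈-concat⁺′)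
  open import Data.List.Properties using (filter-none; filter-accept; filter-reject)
  open import Data.List.Relation.Unary.Any using (here; index)
  open import Data.List.Relation.Unary.Any.Properties using (lookup-index)
  open import Data.List.Relation.Unary.All as All using (All)
  import Data.List.Relation.Unary.All.Properties as All
  import Data.List.Relation.Unary.AllPairs as AllPairs
  open import Data.List.Relation.Unary.AllPairs using (_∷_)
  import Data.List.Relation.Unary.AllPairs.Properties as AllPairs
  open import Data.List.Relation.Unary.Unique.Propositional using (Unique)
  import Data.List.Relation.Unary.Unique.Propositional.Properties as Unique
  open import Data.Product using (_×_; _,_; proj₁; proj₂)
  open import Data.Empty using (⊥-elim)
  open import Function using (_∘_)
  open import Relation.Nullary using (¬_; Dec; yes; no)
  open import Relation.Nullary.Decidable using (_×-dec_)
  open import Relation.Unary using (Pred; Decidable)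
  open import Relation.Binary.Definitions using (_Respects_)
  open import Relation.Binary.PropositionalEquality
  open import Algebra.Properties.CommutativeMonoid.Sum +-0-commutativeMonoid
    using (sum; sum-remove; sum-cong-≗; sum-replicate-zero)
  open import Defs using (allVecs)

  lookup-injective : ∀ {A : Set} {xs : List A} → Unique xs →
                     ∀ {i j} → List.lookup xs i ≡ List.lookup xs j → i ≡ j
  lookup-injective {xs = _ ∷ _} (_    ∷ _) {zero}  {zero}  _  = refl
  lookup-injective {xs = _ ∷ _} (x∉xs ∷ _) {zero}  {suc j} eq = ⊥-elim (All.lookup x∉xs (∈-lookup j) eq)
  lookup-injective {xs = _ ∷ _} (x∉xs ∷ _) {suc i} {zero}  eq = ⊥-elim (All.lookup x∉xs (∈-lookup i) (sym eq))
  lookup-injective {xs = _ ∷ _} (_ ∷ uxs)  {suc i} {suc j} eq = cong suc (lookup-injective uxs eq)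

  length-≤-injection : ∀ {A B : Set} {xs : List A} {ys : List B} → Unique xs → (f : A → B) →
                       (∀ {x y} → x ∈ xs → y ∈ xs → f x ≡ f y → x ≡ y) →
                       (∀ {x} → x ∈ xs → f x ∈ ys) →
                       length xs ≤ length ys
  length-≤-injection {xs = xs} {ys} uxs f f-inj f-maps = injective⇒≤ index-inj
    where
    position : Fin (length xs) → Fin (length ys)
    position i = index (f-maps (∈-lookup i))

    index-inj : ∀ {i j} → position i ≡ position j → i ≡ j
    index-inj {i} {j} eq = lookup-injective uxs (f-inj (∈-lookup i) (∈-lookup j) (begin
      f (List.lookup xs i)         ≡⟨ lookup-index (f-maps (∈-lookup i)) ⟩
      List.lookup ys (position i)  ≡⟨ cong (List.lookup ys) eq ⟩
      List.lookup ys (position j)  ≡⟨ lookup-index (f-maps (∈-lookup j)) ⟨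
      f (List.lookup xs j)         ∎))
      where open ≡-Reasoning

  record Enumeration (A : Set) : Set where
    field
      elements : List A
      unique   : Unique elements
      complete : ∀ x → x ∈ elements

  open Enumeration

  count : ∀ {A : Set} {P : Pred A 0ℓ} → Enumeration A → Decidable P → ℕ
  count E P? = length (filter P? (elements E))

  record Correspondence {A B : Set} (P : Pred A 0ℓ) (Q : Pred B 0ℓ) : Set where
    field
      to        : A → B
      from      : B → A
      to-pres   : ∀ {x} → P x → Q (to x)
      from-pres : ∀ {y} → Q y → P (from y)
      from∘to   : ∀ {x} → P x → from (to x) ≡ x
      to∘from   : ∀ {y} → Q y → to (from y) ≡ y

    inverse : Correspondence Q P
    inverse = record { to = from ; from = to ; to-pres = from-pres ; from-pres = to-pres
                     ; from∘to = to∘from ; to∘from = from∘to }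

  module _ {A B : Set} {P : Pred A 0ℓ} {Q : Pred B 0ℓ} (EA : Enumeration A) (EB : Enumeration B)
           (P? : Decidable P) (Q? : Decidable Q) where

    count-≤ : Correspondence P Q → count EA P? ≤ count EB Q?
    count-≤ c = length-≤-injection (Unique.filter⁺ P? (unique EA)) to to-inj to-maps
      where
      open Correspondence c
      holds : ∀ {x} → x ∈ filter P? (elements EA) → P x
      holds x∈ = proj₂ (∈-filter⁻ P? {xs = elements EA} x∈)
      to-inj : ∀ {x y} → x ∈ filter P? (elements EA) → y ∈ filter P? (elements EA) → to x ≡ to y → x ≡ y
      to-inj x∈ y∈ eq = trans (sym (from∘to (holds x∈))) (trans (cong from eq) (from∘to (holds y∈)))
      to-maps : ∀ {x} → x ∈ filter P? (elements EA) → to x ∈ filter Q? (elements EB)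
      to-maps x∈ = ∈-filter⁺ Q? (complete EB _) (to-pres (holds x∈))

  count-≡ : ∀ {A B : Set} {P : Pred A 0ℓ} {Q : Pred B 0ℓ} (EA : Enumeration A) (EB : Enumeration B)
            (P? : Decidable P) (Q? : Decidable Q) → Correspondence P Q → count EA P? ≡ count EB Q?
  count-≡ EA EB P? Q? c = ≤-antisym (count-≤ EA EB P? Q? c) (count-≤ EB EA Q? P? (Correspondence.inverse c))

  count-none : ∀ {A : Set} {P : Pred A 0ℓ} (E : Enumeration A) (P? : Decidable P) → (∀ x → ¬ P x) → count E P? ≡ 0
  count-none E P? ¬P = cong length (filter-none P? {xs = elements E} (All.tabulate (λ {x} _ → ¬P x)))

  sum-suc-at : ∀ {n} (k : Fin n) (F G : Fin n → ℕ) → F k ≡ suc (G k) → (∀ j → j ≢ k → F j ≡ G j) →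
               sum F ≡ suc (sum G)
  sum-suc-at {suc _} k F G Fk≡1+Gk F≡G = begin
    sum F                           ≡⟨ sum-remove {i = k} F ⟩
    F k + sum (removeAt F k)        ≡⟨ cong₂ _+_ Fk≡1+Gk (sum-cong-≗ (λ j → F≡G (punchIn k j) (punchInᵢ≢i k j))) ⟩
    suc (G k + sum (removeAt G k))  ≡⟨ cong suc (sum-remove {i = k} G) ⟨
    suc (sum G)                     ∎
    where open ≡-Reasoning

  count-partition : ∀ {A : Set} {P : Pred A 0ℓ} (P? : Decidable P) {n} (h : A → Fin n) (xs : List A) →
                    length (filter P? xs) ≡ sum (λ j → length (filter (λ x → P? x ×-dec (h x ≟ᶠ j)) xs))
  count-partition P? {n} h [] = sym (sum-replicate-zero n)
  count-partition {P = P} P? {n} h (x ∷ xs) = by-cases (P? x)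
    where
    R? : ∀ j → Decidable (λ y → P y × h y ≡ j)
    R? j y = P? y ×-dec (h y ≟ᶠ j)

    by-cases : Dec (P x) →
               length (filter P? (x ∷ xs)) ≡ sum (λ j → length (filter (R? j) (x ∷ xs)))
    by-cases (yes px) = begin
      length (filter P? (x ∷ xs))                ≡⟨ cong length (filter-accept P? px) ⟩
      suc (length (filter P? xs))                ≡⟨ cong suc (count-partition P? h xs) ⟩
      suc (sum (λ j → length (filter (R? j) xs))) ≡⟨ sum-suc-at (h x) _ _ at-hx elsewhere ⟨
      sum (λ j → length (filter (R? j) (x ∷ xs))) ∎
      where
      open ≡-Reasoning
      at-hx : length (filter (R? (h x)) (x ∷ xs)) ≡ suc (length (filter (R? (h x)) xs))
      at-hx = cong length (filter-accept (R? (h x)) (px , refl))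
      elsewhere : ∀ j → j ≢ h x → length (filter (R? j) (x ∷ xs)) ≡ length (filter (R? j) xs)
      elsewhere j j≢hx = cong length (filter-reject (R? j) (λ (_ , hx≡j) → j≢hx (sym hx≡j)))
    by-cases (no ¬px) = begin
      length (filter P? (x ∷ xs))                 ≡⟨ cong length (filter-reject P? ¬px) ⟩
      length (filter P? xs)                       ≡⟨ count-partition P? h xs ⟩
      sum (λ j → length (filter (R? j) xs))       ≡⟨ sum-cong-≗ (λ j → cong length (filter-reject (R? j) (¬px ∘ proj₁))) ⟨
      sum (λ j → length (filter (R? j) (x ∷ xs))) ∎
      where open ≡-Reasoning

  allVecs-complete : ∀ m k (v : Vec (Fin m) k) → v ∈ allVecs m k
  allVecs-complete m zero    []      = here refl
  allVecs-complete m (suc k) (i ∷ v) =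
    ∈-concat⁺′ (∈-map⁺ (i ∷_) (allVecs-complete m k v)) (∈-map⁺ (λ j → map (j ∷_) (allVecs m k)) (∈-allFin i))

  allVecs-unique : ∀ m k → Unique (allVecs m k)
  allVecs-unique m zero    = All.[] AllPairs.∷ AllPairs.[]
  allVecs-unique m (suc k) = Unique.concat⁺
    (All.map⁺ (All.tabulate (λ _ → Unique.map⁺ (proj₂ ∘ ∷-injective) (allVecs-unique m k))))
    (AllPairs.map⁺ (AllPairs.map (λ i≢j {v} (p , q) → i≢j (same-head p q)) (Unique.allFin⁺ m)))
    where
    same-head : ∀ {i j} {v : Vec (Fin m) (suc k)} →
                v ∈ map (i ∷_) (allVecs m k) → v ∈ map (j ∷_) (allVecs m k) → i ≡ j
    same-head p q with ∈-map⁻ (_ ∷_) p | ∈-map⁻ (_ ∷_) q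
    ... | _ , _ , refl | _ , _ , v≡j∷w = proj₁ (∷-injective v≡j∷w)

  vectors : ∀ m k → Enumeration (Vec (Fin m) k)
  vectors m k = record { elements = allVecs m k ; unique = allVecs-unique m k ; complete = allVecs-complete m k }

  Endo : ℕ → Set
  Endo m = Fin m → Fin m

  record EndoCorrespondence {a b} (P : Pred (Endo a) 0ℓ) (Q : Pred (Endo b) 0ℓ) : Set where
    field
      to        : Endo a → Endo b
      from      : Endo b → Endo a
      to-cong   : ∀ {f g} → f ≗ g → to f ≗ to g
      from-cong : ∀ {f g} → f ≗ g → from f ≗ from g
      to-pres   : ∀ {f} → P f → Q (to f)
      from-pres : ∀ {g} → Q g → P (from g)
      from∘to   : ∀ {f} → P f → from (to f) ≗ f
      to∘from   : ∀ {g} → Q g → to (from g) ≗ g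

  module _ {a b} {P : Pred (Endo a) 0ℓ} {Q : Pred (Endo b) 0ℓ}
           (P-resp : P Respects _≗_) (Q-resp : Q Respects _≗_) (c : EndoCorrespondence P Q) where

    open EndoCorrespondence c

    tabulated : Correspondence (P ∘ lookup) (Q ∘ lookup)
    tabulated = record
      { to        = λ σ → tabulate (to (lookup σ))
      ; from      = λ τ → tabulate (from (lookup τ))
      ; to-pres   = λ p → Q-resp (sym ∘ lookup∘tabulate _) (to-pres p)
      ; from-pres = λ q → P-resp (sym ∘ lookup∘tabulate _) (from-pres q)
      ; from∘to   = λ {σ} p → trans (tabulate-cong (λ i → trans (from-cong (lookup∘tabulate _) i) (from∘to p i)))
                                    (tabulate∘lookup σ)
      ; to∘from   = λ {τ} q → trans (tabulate-cong (λ i → trans (to-cong (lookup∘tabulate _) i) (to∘from q i)))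
                                    (tabulate∘lookup τ)
      }

    count-endo-≡ : (P? : Decidable (P ∘ lookup)) (Q? : Decidable (Q ∘ lookup)) →
                   count (vectors a a) P? ≡ count (vectors b b) Q?
    count-endo-≡ P? Q? = count-≡ (vectors a a) (vectors b b) P? Q? tabulated

  retarget : ∀ {a b} {P : Pred (Endo a) 0ℓ} {Q Q′ : Pred (Endo b) 0ℓ} → EndoCorrespondence P Q →
             (∀ {g} → Q g → Q′ g) → (∀ {g} → Q′ g → Q g) → EndoCorrespondence P Q′
  retarget c Q⇒Q′ Q′⇒Q = record
    { to = to ; from = from ; to-cong = to-cong ; from-cong = from-cong
    ; to-pres = Q⇒Q′ ∘ to-pres ; from-pres = from-pres ∘ Q′⇒Q
    ; from∘to = from∘to ; to∘from = to∘from ∘ Q′⇒Q }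
    where open EndoCorrespondence c

  sum-const : ∀ n c → sum {n} (λ _ → c) ≡ n * c
  sum-const zero    c = refl
  sum-const (suc n) c = cong (c +_) (sum-const n c)

module Transpositions where

  open import Data.Fin using (Fin)
  open import Data.Fin.Properties using () renaming (_≟_ to _≟ᶠ_)
  open import Data.Fin.Permutation.Components using (transpose)
  open import Function using (_∘_)
  open import Relation.Nullary using (yes; no)
  open import Relation.Nullary.Decidable using (dec-true; dec-false)
  open import Relation.Binary.PropositionalEquality

  data Among {n} (a b x : Fin n) : Set where
    is-left  : x ≡ a → Among a b x
    is-right : x ≡ b → Among a b x
    neither  : x ≢ a → x ≢ b → Among a b x

  among : ∀ {n} (a b x : Fin n) → Among a b x
  among a b x with x ≟ᶠ a | x ≟ᶠ b
  ... | yes x≡a | _       = is-left x≡a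
  ... | no _    | yes x≡b = is-right x≡b
  ... | no x≢a  | no x≢b  = neither x≢a x≢b

  module _ {n} (i j : Fin n) where

    transpose-left : transpose i j i ≡ j
    transpose-left rewrite dec-true (i ≟ᶠ i) refl = refl

    transpose-right : transpose i j j ≡ i
    transpose-right with j ≟ᶠ i
    ... | yes j≡i = j≡i
    ... | no _ rewrite dec-true (j ≟ᶠ j) refl = refl

    transpose-neither : ∀ {k} → k ≢ i → k ≢ j → transpose i j k ≡ k
    transpose-neither {k} k≢i k≢j rewrite dec-false (k ≟ᶠ i) k≢i | dec-false (k ≟ᶠ j) k≢j = refl

    transpose-involutive : ∀ k → transpose i j (transpose i j k) ≡ k
    transpose-involutive k with among i j k
    ... | is-left refl    = trans (cong (transpose k j) transpose-left) transpose-right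
    ... | is-right refl   = trans (cong (transpose i k) transpose-right) transpose-left
    ... | neither k≢i k≢j = trans (cong (transpose i j) (transpose-neither k≢i k≢j)) (transpose-neither k≢i k≢j)

  transpose-natural : ∀ {n} (f : Fin n → Fin n) → (∀ {x y} → f x ≡ f y → x ≡ y) →
                      ∀ i j k → f (transpose i j k) ≡ transpose (f i) (f j) (f k)
  transpose-natural f f-inj i j k with among i j k
  ... | is-left refl    = trans (cong f (transpose-left k j)) (sym (transpose-left (f k) (f j)))
  ... | is-right refl   = trans (cong f (transpose-right i k)) (sym (transpose-right (f i) (f k)))
  ... | neither k≢i k≢j = trans (cong f (transpose-neither i j k≢i k≢j))
                                (sym (transpose-neither (f i) (f j) (k≢i ∘ f-inj) (k≢j ∘ f-inj)))

  transpose-commute : ∀ {n} {i j k l : Fin n} → i ≢ k → i ≢ l → j ≢ k → j ≢ l →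
                      ∀ x → transpose i j (transpose k l x) ≡ transpose k l (transpose i j x)
  transpose-commute {i = i} {j} {k} {l} i≢k i≢l j≢k j≢l x with among i j x | among k l x
  ... | is-left refl  | _ = trans (cong (transpose x j) (transpose-neither k l i≢k i≢l))
                                  (trans (transpose-left x j) (sym (trans (cong (transpose k l) (transpose-left x j))
                                                                          (transpose-neither k l j≢k j≢l))))
  ... | is-right refl | _ = trans (cong (transpose i x) (transpose-neither k l j≢k j≢l))
                                  (trans (transpose-right i x) (sym (trans (cong (transpose k l) (transpose-right i x))
                                                                           (transpose-neither k l i≢k i≢l))))
  ... | neither x≢i x≢j | is-left refl =
    trans (cong (transpose i j) (transpose-left x l))
          (trans (transpose-neither i j (i≢l ∘ sym) (j≢l ∘ sym))
                 (sym (trans (cong (transpose x l) (transpose-neither i j x≢i x≢j)) (transpose-left x l))))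
  ... | neither x≢i x≢j | is-right refl =
    trans (cong (transpose i j) (transpose-right k x))
          (trans (transpose-neither i j (i≢k ∘ sym) (j≢k ∘ sym))
                 (sym (trans (cong (transpose k x) (transpose-neither i j x≢i x≢j)) (transpose-right k x))))
  ... | neither x≢i x≢j | neither x≢k x≢l =
    trans (cong (transpose i j) (transpose-neither k l x≢k x≢l))
          (trans (transpose-neither i j x≢i x≢j)
                 (sym (trans (cong (transpose k l) (transpose-neither i j x≢i x≢j)) (transpose-neither k l x≢k x≢l))))

module Ends where

  open import Data.Nat using (ℕ; zero; suc; _+_; _*_)
  open import Data.Nat.Properties using (+-suc; +-0-commutativeMonoid)
  open import Data.Fin using (Fin; zero; suc; fromℕ; inject₁; opposite)
  open import Data.Fin.Properties using (fromℕ≢inject₁; inject₁-injective; opposite-involutive)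
    renaming (suc-injective to fsuc-injective)
  import Data.Fin.Relation.Unary.Top as Top
  open import Function using (_∘_)
  open import Relation.Binary.PropositionalEquality
  open import Algebra.Properties.CommutativeMonoid.Sum +-0-commutativeMonoid using (sum; sum-init-last)

  inner : ∀ {M} → Fin M → Fin (2 + M)
  inner k = suc (inject₁ k)

  final : ∀ {M} → Fin (2 + M)
  final {M} = suc (fromℕ M)

  data Location {M} (x : Fin (2 + M)) : Set where
    at-first : x ≡ zero → Location x
    at-final : x ≡ final → Location x
    at-inner : ∀ k → x ≡ inner k → Location x

  locate : ∀ {M} (x : Fin (2 + M)) → Location x
  locate zero = at-first refl
  locate (suc y) with Top.view y
  ... | Top.‵fromℕ     = at-final refl
  ... | Top.‵inject₁ k = at-inner k refl

  byPosition : ∀ {M} {A : Set} → A → A → (Fin M → A) → Fin (2 + M) → A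
  byPosition a b f zero = a
  byPosition a b f (suc y) with Top.view y
  ... | Top.‵fromℕ     = b
  ... | Top.‵inject₁ k = f k

  module _ {M} {A : Set} (a b : A) (f : Fin M → A) where

    byPosition-final : byPosition a b f final ≡ b
    byPosition-final rewrite Top.view-fromℕ M = refl

    byPosition-inner : ∀ k → byPosition a b f (inner k) ≡ f k
    byPosition-inner k rewrite Top.view-inject₁ k = refl

  inner-injective : ∀ {M} {k l : Fin M} → inner k ≡ inner l → k ≡ l
  inner-injective = inject₁-injective ∘ fsuc-injective

  inner≢final : ∀ {M} (k : Fin M) → inner k ≢ final
  inner≢final k eq = fromℕ≢inject₁ (sym (fsuc-injective eq))

  opposite-injective : ∀ {m} {x y : Fin m} → opposite x ≡ opposite y → x ≡ y
  opposite-injective {x = x} {y} eq =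
    trans (sym (opposite-involutive x)) (trans (cong opposite eq) (opposite-involutive y))

  opposite-inject₁ : ∀ {M} (k : Fin M) → opposite (inject₁ k) ≡ suc (opposite k)
  opposite-inject₁ {suc M} zero    = refl
  opposite-inject₁ {suc M} (suc k) = cong inject₁ (opposite-inject₁ k)

  opposite-fromℕ : ∀ M → opposite (fromℕ M) ≡ zero
  opposite-fromℕ zero    = refl
  opposite-fromℕ (suc M) = cong inject₁ (opposite-fromℕ M)

  opposite-inner : ∀ {M} (k : Fin M) → opposite (inner k) ≡ inner (opposite k)
  opposite-inner k = cong inject₁ (opposite-inject₁ k)

  opposite-final : ∀ {M} → opposite (final {M}) ≡ zero
  opposite-final {M} = cong inject₁ (opposite-fromℕ M)

  -- Unlike 2 * n, double (suc n) reduces to 2 + double n, the shape needed to split off the end points.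
  double : ℕ → ℕ
  double zero    = 0
  double (suc n) = 2 + double n

  double≡2* : ∀ n → double n ≡ 2 * n
  double≡2* zero    = refl
  double≡2* (suc n) = cong suc (trans (cong suc (double≡2* n)) (sym (+-suc n (n + 0))))

  opposite-≢-2+ : ∀ {M} → (∀ (k : Fin M) → opposite k ≢ k) → ∀ (x : Fin (2 + M)) → opposite x ≢ x
  opposite-≢-2+ {M} opposite-≢ᴹ x with locate x
  ... | at-first refl   = λ ()
  ... | at-final refl   = λ eq → 0≢final (trans (sym opposite-final) eq)
    where 0≢final : zero ≢ final {M}
          0≢final ()
  ... | at-inner k refl = λ eq → opposite-≢ᴹ k (inner-injective (trans (sym (opposite-inner k)) eq))

  opposite-≢ : ∀ n (x : Fin (double n)) → opposite x ≢ x
  opposite-≢ (suc n) = opposite-≢-2+ (opposite-≢ n)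

  sum-ends : ∀ {M} (F : Fin (2 + M) → ℕ) → sum F ≡ F zero + (sum (F ∘ inner) + F final)
  sum-ends F = cong (F zero +_) (sum-init-last (F ∘ suc))

module SymmetricMatchings where

  open import Level using (0ℓ)
  open import Data.Nat using (ℕ; zero; suc; _+_; _*_)
  open import Data.Nat.Properties using (+-0-commutativeMonoid)
  open import Data.Fin using (Fin; zero; suc; opposite)
  open import Data.Fin.Properties using (opposite-involutive) renaming (_≟_ to _≟ᶠ_)
  open import Data.Fin.Permutation.Components using (transpose)
  open import Data.Vec using (lookup)
  open import Data.Product using (_×_; _,_; ∃; proj₁; proj₂)
  open import Data.Empty using (⊥-elim)
  open import Function using (id; _∘_)
  open import Relation.Nullary using (yes; no)
  open import Relation.Nullary.Decidable using (_×-dec_)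
  open import Relation.Unary using (Pred)
  open import Relation.Binary.Definitions using (_Respects_)
  open import Relation.Binary.PropositionalEquality
  open import Algebra.Properties.CommutativeMonoid.Sum +-0-commutativeMonoid using (sum; sum-cong-≗)
  open import Defs using (allVecs; isBSM?; bsm)
  open Counting
  open Transpositions
  open Ends

  Matching : ∀ {m} → Pred (Endo m) 0ℓ
  Matching g = ∀ i → g (g i) ≡ i × g i ≢ i

  Symmetric : ∀ {m} → Pred (Endo m) 0ℓ
  Symmetric g = ∀ i → g (opposite i) ≡ opposite (g i)

  BSM : ∀ {m} → Pred (Endo m) 0ℓ
  BSM g = Matching g × Symmetric g

  Paired : ∀ {m} → Fin m → Fin m → Pred (Endo m) 0ℓ
  Paired a b g = BSM g × g a ≡ b

  mkBSM : ∀ {m} {g : Endo m} → (∀ i → g (g i) ≡ i) → (∀ i → g i ≢ i) → Symmetric g → BSM g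
  mkBSM inv fpf sym = (λ i → inv i , fpf i) , sym

  module BSM {m} {g : Endo m} (bsm : BSM g) where

    involutive : ∀ i → g (g i) ≡ i
    involutive i = proj₁ (proj₁ bsm i)

    fixed-point-free : ∀ i → g i ≢ i
    fixed-point-free i = proj₂ (proj₁ bsm i)

    symmetric : Symmetric g
    symmetric = proj₂ bsm

    partner : ∀ {i j} → g i ≡ j → g j ≡ i
    partner {i} gi≡j = trans (cong g (sym gi≡j)) (involutive i)

  BSM-resp : ∀ {m} → BSM {m} Respects _≗_
  BSM-resp {x = g} {h} g≗h bsm = mkBSM
    (λ i → trans (cong h (sym (g≗h i))) (trans (sym (g≗h (g i))) (involutive i)))
    (λ i hi≡i → fixed-point-free i (trans (g≗h i) hi≡i))
    (λ i → trans (sym (g≗h (opposite i))) (trans (symmetric i) (cong opposite (g≗h i))))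
    where open BSM bsm

  Paired-resp : ∀ {m} (a b : Fin m) → Paired a b Respects _≗_
  Paired-resp a b g≗h (bsm , ga≡b) = BSM-resp g≗h bsm , trans (sym (g≗h a)) ga≡b

  bsmCount : ℕ → ℕ
  bsmCount m = count (vectors m m) isBSM?

  pairedCount : ∀ m → Fin m → Fin m → ℕ
  pairedCount m a b = count (vectors m m) (λ σ → isBSM? σ ×-dec (lookup σ a ≟ᶠ b))

  module Contraction {M} (opposite-≢ᴹ : ∀ (k : Fin M) → opposite k ≢ k) where

    -- On the first and final points `innerIndex d` takes the junk value `opposite d`: thus `contract σ`
    -- joins the partners inner i and opposite (inner i) of the deleted end points into the block {i, opposite i}.
    innerIndex : Fin M → Fin (2 + M) → Fin M
    innerIndex d = byPosition (opposite d) (opposite d) id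

    innerIndex-final : ∀ d → innerIndex d final ≡ opposite d
    innerIndex-final d = byPosition-final (opposite d) (opposite d) id

    innerIndex-inner : ∀ d j → innerIndex d (inner j) ≡ j
    innerIndex-inner d = byPosition-inner (opposite d) (opposite d) id

    contract : Endo (2 + M) → Endo M
    contract σ k = innerIndex k (σ (inner k))

    expand : Fin (2 + M) → Endo M → Endo (2 + M)
    expand y τ x with x ≟ᶠ y
    ... | yes _ = zero
    ... | no _ with x ≟ᶠ opposite y
    ...   | yes _ = final
    ...   | no _  = byPosition y (opposite y) (inner ∘ τ) x

    Compatible : Fin (2 + M) → Pred (Endo M) 0ℓ
    Compatible y τ = ∀ i → inner i ≡ y → τ i ≡ opposite i

    module _ {σ : Endo (2 + M)} (bsm : BSM σ) where

      open BSM bsm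

      σ-inner-opposite : ∀ k → σ (inner (opposite k)) ≡ opposite (σ (inner k))
      σ-inner-opposite k = trans (cong σ (sym (opposite-inner k))) (symmetric (inner k))

      contract-at-first : ∀ {k} → σ (inner k) ≡ zero → contract σ k ≡ opposite k
      contract-at-first = cong (innerIndex _)

      contract-at-final : ∀ {k} → σ (inner k) ≡ final → contract σ k ≡ opposite k
      contract-at-final {k} eq = trans (cong (innerIndex k) eq) (innerIndex-final k)

      contract-at-inner : ∀ {k j} → σ (inner k) ≡ inner j → contract σ k ≡ j
      contract-at-inner {k} {j} eq = trans (cong (innerIndex k) eq) (innerIndex-inner k j)

      σ-inner-opposite-first : ∀ {k} → σ (inner k) ≡ zero → σ (inner (opposite k)) ≡ final
      σ-inner-opposite-first eq = trans (σ-inner-opposite _) (cong opposite eq)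

      σ-inner-opposite-final : ∀ {k} → σ (inner k) ≡ final → σ (inner (opposite k)) ≡ zero
      σ-inner-opposite-final eq = trans (σ-inner-opposite _) (trans (cong opposite eq) opposite-final)

      contract-involutive : ∀ k → contract σ (contract σ k) ≡ k
      contract-involutive k with locate (σ (inner k))
      ... | at-first eq   = trans (cong (contract σ) (contract-at-first eq))
                                  (trans (contract-at-final (σ-inner-opposite-first eq)) (opposite-involutive k))
      ... | at-final eq   = trans (cong (contract σ) (contract-at-final eq))
                                  (trans (contract-at-first (σ-inner-opposite-final eq)) (opposite-involutive k))
      ... | at-inner j eq = trans (cong (contract σ) (contract-at-inner eq)) (contract-at-inner (partner eq))

      contract-fixed-point-free : ∀ k → contract σ k ≢ k
      contract-fixed-point-free k with locate (σ (inner k))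
      ... | at-first eq   = opposite-≢ᴹ k ∘ trans (sym (contract-at-first eq))
      ... | at-final eq   = opposite-≢ᴹ k ∘ trans (sym (contract-at-final eq))
      ... | at-inner j eq = λ sk≡k → fixed-point-free (inner k) (trans eq (cong inner (trans (sym (contract-at-inner eq)) sk≡k)))

      contract-symmetric : Symmetric (contract σ)
      contract-symmetric k with locate (σ (inner k))
      ... | at-first eq   = trans (contract-at-final (σ-inner-opposite-first eq)) (cong opposite (sym (contract-at-first eq)))
      ... | at-final eq   = trans (contract-at-first (σ-inner-opposite-final eq)) (cong opposite (sym (contract-at-final eq)))
      ... | at-inner j eq = trans (contract-at-inner (trans (σ-inner-opposite k) (trans (cong opposite eq) (opposite-inner j))))
                                  (cong opposite (sym (contract-at-inner eq)))

      contract-BSM : BSM (contract σ)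
      contract-BSM = mkBSM contract-involutive contract-fixed-point-free contract-symmetric

      contract-compatible : Compatible (σ zero) (contract σ)
      contract-compatible i eq = contract-at-first (partner (sym eq))

    module Expansion (y : Fin (2 + M)) (y≢0 : y ≢ zero) where

      opposite-elsewhere : ∀ {x} → x ≢ y → x ≢ opposite y → opposite x ≢ y × opposite x ≢ opposite y
      opposite-elsewhere x≢y x≢y′ =
        (λ eq → x≢y′ (trans (sym (opposite-involutive _)) (cong opposite eq))) , (λ eq → x≢y (opposite-injective eq))

      y≡final : opposite y ≡ zero → y ≡ final
      y≡final eq = trans (sym (opposite-involutive y)) (cong opposite eq)

      opposite-y≢final : opposite y ≢ final
      opposite-y≢final eq = y≢0 (trans (sym (opposite-involutive y)) (trans (cong opposite eq) opposite-final))

      module _ (τ : Endo M) where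

        expand-y : expand y τ y ≡ zero
        expand-y with y ≟ᶠ y
        ... | yes _  = refl
        ... | no y≢y = ⊥-elim (y≢y refl)

        expand-opposite : expand y τ (opposite y) ≡ final
        expand-opposite with opposite y ≟ᶠ y
        ... | yes eq = ⊥-elim (opposite-≢-2+ opposite-≢ᴹ y eq)
        ... | no _ with opposite y ≟ᶠ opposite y
        ...   | yes _ = refl
        ...   | no ne = ⊥-elim (ne refl)

        expand-elsewhere : ∀ {x} → x ≢ y → x ≢ opposite y → expand y τ x ≡ byPosition y (opposite y) (inner ∘ τ) x
        expand-elsewhere {x} x≢y x≢y′ with x ≟ᶠ y
        ... | yes eq = ⊥-elim (x≢y eq)
        ... | no _ with x ≟ᶠ opposite y
        ...   | yes eq = ⊥-elim (x≢y′ eq)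
        ...   | no _   = refl

        expand-zero : expand y τ zero ≡ y
        expand-zero with among y (opposite y) zero
        ... | is-left 0≡y    = ⊥-elim (y≢0 (sym 0≡y))
        ... | is-right 0≡y′  = trans (cong (expand y τ) 0≡y′) (trans expand-opposite (sym (y≡final (sym 0≡y′))))
        ... | neither ne ne′ = expand-elsewhere ne ne′

        expand-final : expand y τ final ≡ opposite y
        expand-final with among y (opposite y) final
        ... | is-left f≡y    = trans (cong (expand y τ) f≡y) (trans expand-y (trans (sym opposite-final) (cong opposite f≡y)))
        ... | is-right f≡y′  = ⊥-elim (opposite-y≢final (sym f≡y′))
        ... | neither ne ne′ = trans (expand-elsewhere ne ne′) (byPosition-final y (opposite y) (inner ∘ τ))

        expand-inner : ∀ {k} → inner k ≢ y → inner k ≢ opposite y → expand y τ (inner k) ≡ inner (τ k)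
        expand-inner {k} ne ne′ = trans (expand-elsewhere ne ne′) (byPosition-inner y (opposite y) (inner ∘ τ) k)

      expand-cong : ∀ {τ τ′} → τ ≗ τ′ → expand y τ ≗ expand y τ′
      expand-cong {τ} {τ′} τ≗τ′ x with among y (opposite y) x
      ... | is-left refl  = trans (expand-y τ) (sym (expand-y τ′))
      ... | is-right refl = trans (expand-opposite τ) (sym (expand-opposite τ′))
      ... | neither ne ne′ with locate x
      ...   | at-first refl   = trans (expand-zero τ) (sym (expand-zero τ′))
      ...   | at-final refl   = trans (expand-final τ) (sym (expand-final τ′))
      ...   | at-inner k refl = trans (expand-inner τ ne ne′) (trans (cong inner (τ≗τ′ k)) (sym (expand-inner τ′ ne ne′)))

      module _ {τ : Endo M} (bsm : BSM τ) (compatible : Compatible y τ) where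

        open BSM bsm

        inner-partner-elsewhere : ∀ {k} → inner k ≢ y → inner k ≢ opposite y → inner (τ k) ≢ y × inner (τ k) ≢ opposite y
        inner-partner-elsewhere {k} k≢y k≢y′ = (λ eq → k≢y′ (at-y eq)) , (λ eq → k≢y (at-opposite eq))
          where
          open ≡-Reasoning
          at-y : inner (τ k) ≡ y → inner k ≡ opposite y
          at-y eq = begin
            inner k                    ≡⟨ cong inner (trans (sym (involutive k)) (compatible (τ k) eq)) ⟩
            inner (opposite (τ k))     ≡⟨ opposite-inner (τ k) ⟨
            opposite (inner (τ k))     ≡⟨ cong opposite eq ⟩
            opposite y                 ∎
          mirror : inner (τ k) ≡ opposite y → inner (opposite (τ k)) ≡ y
          mirror eq = begin
            inner (opposite (τ k))     ≡⟨ opposite-inner (τ k) ⟨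
            opposite (inner (τ k))     ≡⟨ cong opposite eq ⟩
            opposite (opposite y)      ≡⟨ opposite-involutive y ⟩
            y                          ∎
          at-opposite : inner (τ k) ≡ opposite y → inner k ≡ y
          at-opposite eq = begin
            inner k                          ≡⟨ cong inner (opposite-involutive k) ⟨
            inner (opposite (opposite k))    ≡⟨ cong (inner ∘ opposite) opposite-k≡τk ⟩
            inner (opposite (τ k))           ≡⟨ mirror eq ⟩
            y                                ∎
            where
            opposite-k≡τk : opposite k ≡ τ k
            opposite-k≡τk = begin
              opposite k                     ≡⟨ cong opposite (involutive k) ⟨
              opposite (τ (τ k))             ≡⟨ symmetric (τ k) ⟨
              τ (opposite (τ k))             ≡⟨ compatible (opposite (τ k)) (mirror eq) ⟩
              opposite (opposite (τ k))      ≡⟨ opposite-involutive (τ k) ⟩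
              τ k                            ∎

        expand-involutive : ∀ x → expand y τ (expand y τ x) ≡ x
        expand-involutive x with among y (opposite y) x
        ... | is-left refl  = trans (cong (expand y τ) (expand-y τ)) (expand-zero τ)
        ... | is-right refl = trans (cong (expand y τ) (expand-opposite τ)) (expand-final τ)
        ... | neither ne ne′ with locate x
        ...   | at-first refl   = trans (cong (expand y τ) (expand-zero τ)) (expand-y τ)
        ...   | at-final refl   = trans (cong (expand y τ) (expand-final τ)) (expand-opposite τ)
        ...   | at-inner k refl = trans (cong (expand y τ) (expand-inner τ ne ne′))
                                        (trans (expand-inner τ (proj₁ partner-elsewhere) (proj₂ partner-elsewhere)) (cong inner (involutive k)))
          where partner-elsewhere = inner-partner-elsewhere ne ne′

        expand-fixed-point-free : ∀ x → expand y τ x ≢ x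
        expand-fixed-point-free x with among y (opposite y) x
        ... | is-left refl  = λ eq → y≢0 (trans (sym eq) (expand-y τ))
        ... | is-right refl = λ eq → opposite-y≢final (trans (sym eq) (expand-opposite τ))
        ... | neither ne ne′ with locate x
        ...   | at-first refl   = λ eq → y≢0 (trans (sym (expand-zero τ)) eq)
        ...   | at-final refl   = λ eq → opposite-y≢final (trans (sym (expand-final τ)) eq)
        ...   | at-inner k refl = λ eq → fixed-point-free k (inner-injective (trans (sym (expand-inner τ ne ne′)) eq))

        expand-symmetric : Symmetric (expand y τ)
        expand-symmetric x with among y (opposite y) x
        ... | is-left refl  = trans (expand-opposite τ) (cong opposite (sym (expand-y τ)))
        ... | is-right refl = trans (cong (expand y τ) (opposite-involutive y))
                                    (trans (expand-y τ) (sym (trans (cong opposite (expand-opposite τ)) opposite-final)))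
        ... | neither ne ne′ with locate x
        ...   | at-first refl   = trans (expand-final τ) (cong opposite (sym (expand-zero τ)))
        ...   | at-final refl   = trans (cong (expand y τ) opposite-final)
                                        (trans (expand-zero τ) (sym (trans (cong opposite (expand-final τ)) (opposite-involutive y))))
        ...   | at-inner k refl = begin
          expand y τ (opposite (inner k))  ≡⟨ cong (expand y τ) (opposite-inner k) ⟩
          expand y τ (inner (opposite k))  ≡⟨ expand-inner τ ne₂ ne₂′ ⟩
          inner (τ (opposite k))           ≡⟨ cong inner (symmetric k) ⟩
          inner (opposite (τ k))           ≡⟨ opposite-inner (τ k) ⟨
          opposite (inner (τ k))           ≡⟨ cong opposite (expand-inner τ ne ne′) ⟨
          opposite (expand y τ (inner k))  ∎
          where
          open ≡-Reasoning
          ne₂ : inner (opposite k) ≢ y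
          ne₂ = proj₁ (opposite-elsewhere ne ne′) ∘ trans (opposite-inner k)
          ne₂′ : inner (opposite k) ≢ opposite y
          ne₂′ = proj₂ (opposite-elsewhere ne ne′) ∘ trans (opposite-inner k)

        expand-BSM : BSM (expand y τ)
        expand-BSM = mkBSM expand-involutive expand-fixed-point-free expand-symmetric

        contract-expand : contract (expand y τ) ≗ τ
        contract-expand k with among y (opposite y) (inner k)
        ... | is-left eq     = trans (cong (innerIndex k) (trans (cong (expand y τ) eq) (expand-y τ))) (sym (compatible k eq))
        ... | is-right eq    = trans (cong (innerIndex k) (trans (cong (expand y τ) eq) (expand-opposite τ)))
                                     (trans (innerIndex-final k) (sym (partner (trans (compatible (opposite k) mirror) (opposite-involutive k)))))
          where
          mirror : inner (opposite k) ≡ y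
          mirror = trans (sym (opposite-inner k)) (trans (cong opposite eq) (opposite-involutive y))
        ... | neither ne ne′ = trans (cong (innerIndex k) (expand-inner τ ne ne′)) (innerIndex-inner k (τ k))

      module _ {σ : Endo (2 + M)} (bsm : BSM σ) (σ0≡y : σ zero ≡ y) where

        open BSM bsm

        σ-final : σ final ≡ opposite y
        σ-final = trans (symmetric zero) (cong opposite σ0≡y)

        inner-contract : ∀ {k} → inner k ≢ y → inner k ≢ opposite y → inner (contract σ k) ≡ σ (inner k)
        inner-contract {k} ne ne′ with locate (σ (inner k))
        ... | at-first eq   = ⊥-elim (ne (trans (sym (partner eq)) σ0≡y))
        ... | at-final eq   = ⊥-elim (ne′ (trans (sym (partner eq)) σ-final))
        ... | at-inner j eq = trans (cong inner (contract-at-inner bsm eq)) (sym eq)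

        expand-contract : expand y (contract σ) ≗ σ
        expand-contract x with among y (opposite y) x
        ... | is-left refl  = trans (expand-y _) (sym (partner σ0≡y))
        ... | is-right refl = trans (expand-opposite _) (sym (trans (symmetric y) (cong opposite (partner σ0≡y))))
        ... | neither ne ne′ with locate x
        ...   | at-first refl   = trans (expand-zero _) (sym σ0≡y)
        ...   | at-final refl   = trans (expand-final _) (sym σ-final)
        ...   | at-inner k refl = trans (expand-inner _ ne ne′) (inner-contract ne ne′)

    contraction : (y : Fin (2 + M)) → y ≢ zero → EndoCorrespondence (Paired zero y) (λ τ → BSM τ × Compatible y τ)
    contraction y y≢0 = record
      { to        = contract
      ; from      = expand y
      ; to-cong   = λ σ≗σ′ k → cong (innerIndex k) (σ≗σ′ (inner k))
      ; from-cong = expand-cong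
      ; to-pres   = λ (bsm , σ0≡y) → contract-BSM bsm , subst (λ y → Compatible y _) σ0≡y (contract-compatible bsm)
      ; from-pres = λ (bsm , compatible) → expand-BSM bsm compatible , expand-zero _
      ; from∘to   = λ (bsm , σ0≡y) → expand-contract bsm σ0≡y
      ; to∘from   = λ (bsm , compatible) → contract-expand bsm compatible
      }
      where open Expansion y y≢0

    compatible-final : ∀ {τ} → Compatible final τ
    compatible-final i eq = ⊥-elim (inner≢final i eq)

    compatible-inner : ∀ {τ i} → τ i ≡ opposite i → Compatible (inner i) τ
    compatible-inner τi≡i′ j eq rewrite inner-injective eq = τi≡i′

    pairedCount-final : pairedCount (2 + M) zero final ≡ bsmCount M
    pairedCount-final = count-endo-≡ (Paired-resp zero final) BSM-resp
      (retarget (contraction final (λ ())) proj₁ (_, compatible-final)) _ isBSM?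

    pairedCount-inner : ∀ i → pairedCount (2 + M) zero (inner i) ≡ pairedCount M i (opposite i)
    pairedCount-inner i = count-endo-≡ (Paired-resp zero (inner i)) (Paired-resp i (opposite i))
      (retarget (contraction (inner i) (λ ())) (λ (bsm , compatible) → bsm , compatible i refl)
                                               (λ (bsm , τi≡i′) → bsm , compatible-inner τi≡i′)) _ _

  opposite-transpose : ∀ {n} (i j k : Fin n) → opposite (transpose i j k) ≡ transpose (opposite i) (opposite j) (opposite k)
  opposite-transpose = transpose-natural opposite opposite-injective

  symmetric-involution : ∀ {m} → (∀ (x : Fin m) → opposite x ≢ x) → ∀ (a b : Fin m) →
                         ∃ λ π → (∀ x → π (π x) ≡ x) × Symmetric π × π a ≡ b
  symmetric-involution opposite-≢ᵐ a b with b ≟ᶠ opposite a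
  ... | yes refl = opposite , opposite-involutive , (λ _ → refl) , refl
  ... | no b≢a′  = π , π-involutive , π-symmetric , π-a
    where
    open ≡-Reasoning
    a′ = opposite a
    b′ = opposite b
    τ₁ = transpose a b
    τ₂ = transpose a′ b′
    π = τ₁ ∘ τ₂

    a≢a′ : a ≢ a′
    a≢a′ = opposite-≢ᵐ a ∘ sym
    a≢b′ : a ≢ b′
    a≢b′ eq = b≢a′ (trans (sym (opposite-involutive b)) (cong opposite (sym eq)))
    b≢b′ : b ≢ b′
    b≢b′ = opposite-≢ᵐ b ∘ sym

    commute : ∀ x → τ₁ (τ₂ x) ≡ τ₂ (τ₁ x)
    commute = transpose-commute a≢a′ a≢b′ b≢a′ b≢b′

    π-a : π a ≡ b
    π-a = trans (cong τ₁ (transpose-neither a′ b′ a≢a′ a≢b′)) (transpose-left a b)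

    π-involutive : ∀ x → π (π x) ≡ x
    π-involutive x = begin
      τ₁ (τ₂ (τ₁ (τ₂ x)))  ≡⟨ cong τ₁ (commute (τ₂ x)) ⟨
      τ₁ (τ₁ (τ₂ (τ₂ x)))  ≡⟨ transpose-involutive a b (τ₂ (τ₂ x)) ⟩
      τ₂ (τ₂ x)            ≡⟨ transpose-involutive a′ b′ x ⟩
      x                    ∎

    π-symmetric : Symmetric π
    π-symmetric x = sym (begin
      opposite (τ₁ (τ₂ x))                                    ≡⟨ opposite-transpose a b (τ₂ x) ⟩
      τ₂ (opposite (τ₂ x))                                    ≡⟨ cong τ₂ (opposite-transpose a′ b′ x) ⟩
      τ₂ (transpose (opposite a′) (opposite b′) (opposite x))  ≡⟨ cong₂ (λ u v → τ₂ (transpose u v (opposite x)))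
                                                                        (opposite-involutive a) (opposite-involutive b) ⟩
      τ₂ (τ₁ (opposite x))                                    ≡⟨ commute (opposite x) ⟨
      τ₁ (τ₂ (opposite x))                                    ∎)

  module _ {m} {π : Endo m} (π-involutive : ∀ x → π (π x) ≡ x) (π-symmetric : Symmetric π) where

    conjugate : Endo m → Endo m
    conjugate g = π ∘ g ∘ π

    conjugate-BSM : ∀ {g} → BSM g → BSM (conjugate g)
    conjugate-BSM {g} bsm = mkBSM
      (λ x → trans (cong (π ∘ g) (π-involutive (g (π x)))) (trans (cong π (involutive (π x))) (π-involutive x)))
      (λ x eq → fixed-point-free (π x) (trans (sym (π-involutive (g (π x)))) (cong π eq)))
      (λ x → trans (cong (π ∘ g) (π-symmetric x)) (trans (cong π (symmetric (π x))) (π-symmetric (g (π x)))))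
      where open BSM bsm

    conjugate-involutive : ∀ g → conjugate (conjugate g) ≗ g
    conjugate-involutive g x = trans (π-involutive _) (cong g (π-involutive x))

    conjugation : ∀ a b → EndoCorrespondence (Paired a b) (Paired (π a) (π b))
    conjugation a b = record
      { to        = conjugate
      ; from      = conjugate
      ; to-cong   = λ g≗h x → cong π (g≗h (π x))
      ; from-cong = λ g≗h x → cong π (g≗h (π x))
      ; to-pres   = λ {g} (bsm , ga≡b) → conjugate-BSM bsm , trans (cong (π ∘ g) (π-involutive a)) (cong π ga≡b)
      ; from-pres = λ {g} (bsm , gπa≡πb) → conjugate-BSM bsm , trans (cong π gπa≡πb) (π-involutive b)
      ; from∘to   = λ {g} _ → conjugate-involutive g
      ; to∘from   = λ {g} _ → conjugate-involutive g
      }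

  pairedCount-opposite : ∀ {m} → (∀ (x : Fin m) → opposite x ≢ x) → ∀ a b →
                         pairedCount m a (opposite a) ≡ pairedCount m b (opposite b)
  pairedCount-opposite opposite-≢ᵐ a b with symmetric-involution opposite-≢ᵐ a b
  ... | π , π-involutive , π-symmetric , refl =
    trans (count-endo-≡ (Paired-resp a (opposite a)) (Paired-resp (π a) (π (opposite a)))
                        (conjugation π-involutive π-symmetric a (opposite a)) _ _)
          (cong (pairedCount _ (π a)) (π-symmetric a))

  pairedCount-fixed-point : ∀ m → pairedCount (suc m) zero zero ≡ 0
  pairedCount-fixed-point m = count-none (vectors (suc m) (suc m)) _ (λ σ (bsm , σ0≡0) → BSM.fixed-point-free bsm zero σ0≡0)

  bsmCount-recurrence : ∀ n → bsmCount (double (2 + n)) ≡ double (suc n) * bsmCount (double n) + bsmCount (double (suc n))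
  bsmCount-recurrence n = begin
    bsmCount M₂
      ≡⟨ count-partition isBSM? (λ σ → lookup σ zero) (allVecs M₂ M₂) ⟩
    sum (pairedCount M₂ zero)
      ≡⟨ sum-ends (pairedCount M₂ zero) ⟩
    pairedCount M₂ zero zero + (sum (pairedCount M₂ zero ∘ inner) + pairedCount M₂ zero final)
      ≡⟨ cong₂ (λ c s → c + (s + pairedCount M₂ zero final)) (pairedCount-fixed-point (suc M₁)) (sum-cong-≗ inner-blocks) ⟩
    sum {M₁} (λ _ → bsmCount M₀) + pairedCount M₂ zero final
      ≡⟨ cong₂ _+_ (sum-const M₁ (bsmCount M₀)) (Contraction.pairedCount-final (opposite-≢ (suc n))) ⟩
    M₁ * bsmCount M₀ + bsmCount M₁
      ∎
    where
    open ≡-Reasoning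
    M₀ = double n
    M₁ = double (suc n)
    M₂ = double (2 + n)
    inner-blocks : ∀ i → pairedCount M₂ zero (inner i) ≡ bsmCount M₀
    inner-blocks i = begin
      pairedCount M₂ zero (inner i)           ≡⟨ Contraction.pairedCount-inner (opposite-≢ (suc n)) i ⟩
      pairedCount M₁ i (opposite i)           ≡⟨ pairedCount-opposite (opposite-≢ (suc n)) i zero ⟩
      pairedCount M₁ zero final               ≡⟨ Contraction.pairedCount-final (opposite-≢ n) ⟩
      bsmCount M₀                             ∎

  bsm-as-count : ∀ n → bsm n ≡ bsmCount (double n)
  bsm-as-count n = cong bsmCount (sym (double≡2* n))

  bsm-recurrence : ∀ n → bsm (2 + n) ≡ (2 + 2 * n) * bsm n + bsm (suc n)
  bsm-recurrence n = begin
    bsm (2 + n)                                                        ≡⟨ bsm-as-count (2 + n) ⟩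
    bsmCount (double (2 + n))                                          ≡⟨ bsmCount-recurrence n ⟩
    double (suc n) * bsmCount (double n) + bsmCount (double (suc n))
      ≡⟨ cong₂ _+_ (cong₂ _*_ (cong (2 +_) (sym (double≡2* n))) (bsm-as-count n)) (bsm-as-count (suc n)) ⟨
    (2 + 2 * n) * bsm n + bsm (suc n)                                  ∎
    where open ≡-Reasoning

module Coefficients where

  open import Data.Nat using (ℕ; zero; suc; _+_; _*_; _<_; _!; s≤s)
  open import Data.Nat.Properties using (*-zeroʳ; +-identityʳ; ≤-trans; n≤1+n; ≤-refl)
  open import Data.Nat.Solver using (module +-*-Solver)
  open import Data.Product using (_×_; _,_; proj₁)
  open import Relation.Binary.PropositionalEquality
  open +-*-Solver

  powCoeff : ℕ → ℕ → ℕ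
  powCoeff zero    zero          = 1
  powCoeff zero    (suc n)       = 0
  powCoeff (suc k) zero          = 0
  powCoeff (suc k) (suc zero)    = powCoeff k 0
  powCoeff (suc k) (suc (suc n)) = powCoeff k (suc n) + powCoeff k n

  powCoeff₋₁ : ℕ → ℕ → ℕ
  powCoeff₋₁ k zero    = 0
  powCoeff₋₁ k (suc n) = powCoeff k n

  powCoeff-suc : ∀ k n → powCoeff (suc k) (suc n) ≡ powCoeff k n + powCoeff₋₁ k n
  powCoeff-suc k zero    = sym (+-identityʳ _)
  powCoeff-suc k (suc n) = refl

  -- Coefficient forms of (f^(k+1))′ = (k+1) f^k (1 + 2t) and t (f^(k+1))′ + (k+1) t f^k = 2 (k+1) f^(k+1), f = t + t².
  powCoeff-derivative : ∀ k n → suc n * powCoeff (suc k) (suc n) ≡ suc k * (powCoeff k n + 2 * powCoeff₋₁ k n)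
  powCoeff-euler      : ∀ k n → n * powCoeff (suc k) n + suc k * powCoeff₋₁ k n ≡ suc k * (2 * powCoeff (suc k) n)

  powCoeff-derivative zero    zero          = refl
  powCoeff-derivative zero    (suc zero)    = refl
  powCoeff-derivative zero    (suc (suc n)) = *-zeroʳ (3 + n)
  powCoeff-derivative (suc k) zero          = sym (*-zeroʳ (2 + k))
  powCoeff-derivative (suc k) (suc n)       = begin
    (2 + n) * (powCoeff (suc k) (suc n) + Y)
      ≡⟨ cong (λ z → (2 + n) * (z + Y)) (powCoeff-suc k n) ⟩
    (2 + n) * ((a + b) + Y)
      ≡⟨ solve 4 (λ n a b y → (con 2 :+ n) :* ((a :+ b) :+ y) := ((con 1 :+ n) :* (a :+ b)) :+ (a :+ b :+ n :* y :+ con 2 :* y))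
               refl n a b Y ⟩
    suc n * (a + b) + (a + b + n * Y + 2 * Y)
      ≡⟨ cong (_+ (a + b + n * Y + 2 * Y)) (trans (cong (suc n *_) (sym (powCoeff-suc k n))) (powCoeff-derivative k n)) ⟩
    suc k * (a + 2 * b) + (a + b + n * Y + 2 * Y)
      ≡⟨ solve 5 (λ k a b n y → (con 1 :+ k) :* (a :+ con 2 :* b) :+ (a :+ b :+ n :* y :+ con 2 :* y)
                            := (n :* y :+ (con 1 :+ k) :* b) :+ ((con 1 :+ k) :* a :+ (con 1 :+ k) :* b :+ a :+ b :+ con 2 :* y))
               refl k a b n Y ⟩
    (n * Y + suc k * b) + (suc k * a + suc k * b + a + b + 2 * Y)
      ≡⟨ cong (_+ (suc k * a + suc k * b + a + b + 2 * Y)) (powCoeff-euler k n) ⟩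
    suc k * (2 * Y) + (suc k * a + suc k * b + a + b + 2 * Y)
      ≡⟨ solve 4 (λ k a b y → (con 1 :+ k) :* (con 2 :* y) :+ ((con 1 :+ k) :* a :+ (con 1 :+ k) :* b :+ a :+ b :+ con 2 :* y)
                          := (con 2 :+ k) :* ((a :+ b) :+ con 2 :* y))
               refl k a b Y ⟩
    (2 + k) * ((a + b) + 2 * Y)
      ≡⟨ cong (λ z → (2 + k) * (z + 2 * Y)) (powCoeff-suc k n) ⟨
    (2 + k) * (powCoeff (suc k) (suc n) + 2 * Y)
      ∎
    where
    open ≡-Reasoning
    Y = powCoeff (suc k) n
    a = powCoeff k n
    b = powCoeff₋₁ k n

  powCoeff-euler k zero    = trans (*-zeroʳ (suc k)) (sym (*-zeroʳ (suc k)))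
  powCoeff-euler k (suc n) = begin
    suc n * powCoeff (suc k) (suc n) + suc k * powCoeff k n
      ≡⟨ cong (_+ suc k * powCoeff k n) (powCoeff-derivative k n) ⟩
    suc k * (powCoeff k n + 2 * powCoeff₋₁ k n) + suc k * powCoeff k n
      ≡⟨ solve 3 (λ k a b → (con 1 :+ k) :* (a :+ con 2 :* b) :+ (con 1 :+ k) :* a := (con 1 :+ k) :* (con 2 :* (a :+ b)))
               refl k (powCoeff k n) (powCoeff₋₁ k n) ⟩
    suc k * (2 * (powCoeff k n + powCoeff₋₁ k n))
      ≡⟨ cong (λ z → suc k * (2 * z)) (powCoeff-suc k n) ⟨
    suc k * (2 * powCoeff (suc k) (suc n))
      ∎
    where open ≡-Reasoning

  -- The recurrence of bsm, refined by k; expTerm-factorial identifies expTerm k n with n!/k! [t^n] (t+t²)^k.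
  expTerm : ℕ → ℕ → ℕ
  expTerm zero    zero          = 1
  expTerm zero    (suc n)       = 0
  expTerm (suc k) zero          = 0
  expTerm (suc k) (suc zero)    = expTerm k 0
  expTerm (suc k) (suc (suc n)) = expTerm k (suc n) + (2 + 2 * n) * expTerm k n

  expTerm-factorial : ∀ k n → expTerm k n * k ! ≡ n ! * powCoeff k n
  expTerm-factorial zero          zero          = refl
  expTerm-factorial zero          (suc n)       = sym (*-zeroʳ (suc n !))
  expTerm-factorial (suc k)       zero          = refl
  expTerm-factorial (suc zero)    (suc zero)    = refl
  expTerm-factorial (suc (suc k)) (suc zero)    = refl
  expTerm-factorial (suc k)       (suc (suc n)) = begin
    (d₁ + (2 + 2 * n) * d₀) * (suc k * f)
      ≡⟨ solve 5 (λ d₁ d₀ f k n → (d₁ :+ (con 2 :+ con 2 :* n) :* d₀) :* ((con 1 :+ k) :* f)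
                               := (con 1 :+ k) :* (d₁ :* f) :+ (con 2 :* (con 1 :+ k)) :* ((con 1 :+ n) :* (d₀ :* f)))
               refl d₁ d₀ f k n ⟩
    suc k * (d₁ * f) + (2 * suc k) * (suc n * (d₀ * f))
      ≡⟨ cong₂ (λ u v → suc k * u + (2 * suc k) * (suc n * v)) (expTerm-factorial k (suc n)) (expTerm-factorial k n) ⟩
    suc k * ((suc n * n!) * b₁) + (2 * suc k) * (suc n * (n! * b₀))
      ≡⟨ solve 5 (λ k n f b₁ b₀ → (con 1 :+ k) :* (((con 1 :+ n) :* f) :* b₁) :+ (con 2 :* (con 1 :+ k)) :* ((con 1 :+ n) :* (f :* b₀))
                                := ((con 1 :+ n) :* f) :* ((con 1 :+ k) :* (b₁ :+ con 2 :* b₀)))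
               refl k n n! b₁ b₀ ⟩
    (suc n * n!) * (suc k * (b₁ + 2 * b₀))
      ≡⟨ cong ((suc n * n!) *_) (powCoeff-derivative k (suc n)) ⟨
    (suc n * n!) * ((2 + n) * (b₁ + b₀))
      ≡⟨ solve 4 (λ n f b₁ b₀ → ((con 1 :+ n) :* f) :* ((con 2 :+ n) :* (b₁ :+ b₀)) := ((con 2 :+ n) :* ((con 1 :+ n) :* f)) :* (b₁ :+ b₀))
               refl n n! b₁ b₀ ⟩
    ((2 + n) * (suc n * n!)) * (b₁ + b₀)
      ∎
    where
    open ≡-Reasoning
    d₁ = expTerm k (suc n)
    d₀ = expTerm k n
    f  = k !
    n! = n !
    b₁ = powCoeff k (suc n)
    b₀ = powCoeff k n

  expTerm-vanishes : ∀ {k n} → n < k → expTerm k n ≡ 0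
  expTerm-vanishes {suc k} {zero}        _        = refl
  expTerm-vanishes {suc zero}    {suc zero} (s≤s ())
  expTerm-vanishes {suc (suc k)} {suc zero} _     = refl
  expTerm-vanishes {suc k} {suc (suc n)} (s≤s n<k) =
    trans (cong₂ (λ u v → u + (2 + 2 * n) * v) (expTerm-vanishes n<k) (expTerm-vanishes (≤-trans (n≤1+n _) n<k)))
          (*-zeroʳ (2 + 2 * n))

  sumUpTo : ℕ → (ℕ → ℕ) → ℕ
  sumUpTo zero    f = f 0
  sumUpTo (suc n) f = sumUpTo n f + f (suc n)

  sumUpTo-shift : ∀ n f → sumUpTo (suc n) f ≡ f 0 + sumUpTo n (λ k → f (suc k))
  sumUpTo-shift zero    f = refl
  sumUpTo-shift (suc n) f = begin
    sumUpTo (suc n) f + f (2 + n)                         ≡⟨ cong (_+ f (2 + n)) (sumUpTo-shift n f) ⟩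
    f 0 + sumUpTo n (λ k → f (suc k)) + f (2 + n)        ≡⟨ solve 3 (λ a b c → a :+ b :+ c := a :+ (b :+ c)) refl
                                                                   (f 0) (sumUpTo n (λ k → f (suc k))) (f (2 + n)) ⟩
    f 0 + (sumUpTo n (λ k → f (suc k)) + f (2 + n))      ∎
    where open ≡-Reasoning

  sumUpTo-linear : ∀ n c f g → sumUpTo n (λ k → f k + c * g k) ≡ sumUpTo n f + c * sumUpTo n g
  sumUpTo-linear zero    c f g = refl
  sumUpTo-linear (suc n) c f g = begin
    sumUpTo n (λ k → f k + c * g k) + (f (suc n) + c * g (suc n))
      ≡⟨ cong (_+ (f (suc n) + c * g (suc n))) (sumUpTo-linear n c f g) ⟩
    sumUpTo n f + c * sumUpTo n g + (f (suc n) + c * g (suc n))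
      ≡⟨ solve 5 (λ a c b x y → a :+ c :* b :+ (x :+ c :* y) := a :+ x :+ c :* (b :+ y)) refl
                 (sumUpTo n f) c (sumUpTo n g) (f (suc n)) (g (suc n)) ⟩
    sumUpTo n f + f (suc n) + c * (sumUpTo n g + g (suc n))
      ∎
    where open ≡-Reasoning

  expCoeff : ℕ → ℕ
  expCoeff n = sumUpTo n (λ k → expTerm k n)

  expCoeff-recurrence : ∀ n → expCoeff (2 + n) ≡ (2 + 2 * n) * expCoeff n + expCoeff (suc n)
  expCoeff-recurrence n = begin
    expCoeff (2 + n)
      ≡⟨ sumUpTo-shift (suc n) (λ k → expTerm k (2 + n)) ⟩
    sumUpTo (suc n) (λ k → expTerm k (suc n) + (2 + 2 * n) * expTerm k n)
      ≡⟨ sumUpTo-linear (suc n) (2 + 2 * n) (λ k → expTerm k (suc n)) (λ k → expTerm k n) ⟩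
    expCoeff (suc n) + (2 + 2 * n) * (expCoeff n + expTerm (suc n) n)
      ≡⟨ cong (λ z → expCoeff (suc n) + (2 + 2 * n) * (expCoeff n + z)) (expTerm-vanishes {suc n} {n} ≤-refl) ⟩
    expCoeff (suc n) + (2 + 2 * n) * (expCoeff n + 0)
      ≡⟨ solve 3 (λ a c w → a :+ c :* (w :+ con 0) := c :* w :+ a) refl (expCoeff (suc n)) (2 + 2 * n) (expCoeff n) ⟩
    (2 + 2 * n) * expCoeff n + expCoeff (suc n)
      ∎
    where open ≡-Reasoning

  recurrence-unique : ∀ (c : ℕ → ℕ) {a b : ℕ → ℕ} → a 0 ≡ b 0 → a 1 ≡ b 1 →
                      (∀ n → a (2 + n) ≡ c n * a n + a (suc n)) → (∀ n → b (2 + n) ≡ c n * b n + b (suc n)) →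
                      ∀ n → a n ≡ b n
  recurrence-unique c {a} {b} a₀≡b₀ a₁≡b₁ a-rec b-rec n = proj₁ (consecutive n)
    where
    consecutive : ∀ n → a n ≡ b n × a (suc n) ≡ b (suc n)
    consecutive zero    = a₀≡b₀ , a₁≡b₁
    consecutive (suc n) with consecutive n
    ... | aₙ≡bₙ , aₙ₊₁≡bₙ₊₁ =
      aₙ₊₁≡bₙ₊₁ , trans (a-rec n) (trans (cong₂ (λ u v → c n * u + v) aₙ≡bₙ aₙ₊₁≡bₙ₊₁) (sym (b-rec n)))

open import Defs
open import Data.Nat using (ℕ; _!)
open import Data.Integer using (+_)
open import Data.Rational using (ℚ; _/_; _*_)
open import Relation.Binary.PropositionalEquality using (_≡_)
import Data.Nat as ℕ
open import Data.Nat using (zero; suc; _∸_; NonZero)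
open import Data.Nat.Properties using (_!≢0)
open import Data.Nat.Divisibility using (∣1⇒≡1)
open import Data.Nat.Coprimality using (Coprime)
import Data.Integer as ℤ
import Data.Integer.Properties as ℤ
open import Data.Rational using (mkℚ; _+_; 0ℚ; 1ℚ)
open import Data.Rational.Properties
  using (normalize-coprime; *-inverseʳ; *-distribˡ-+; *-zeroˡ; *-identityˡ; *-identityʳ; +-identityˡ; +-identityʳ; *-assoc; *-comm)
open import Data.Product using (proj₁; proj₂)
open import Function using (_∘_)
open import Relation.Binary.PropositionalEquality using (refl; sym; trans; cong; cong₂; module ≡-Reasoning)
open SymmetricMatchings using (bsm-recurrence)
open Coefficients

toℚ : ℕ → ℚ
toℚ m = + m / 1

1/_! : ℕ → ℚ
1/ k ! = ((+ 1) / (k !)) {{k !≢0}}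

coprime-1 : ∀ {m} → Coprime m 1
coprime-1 = ∣1⇒≡1 ∘ proj₂

toℚ-mkℚ : ∀ m → toℚ m ≡ mkℚ (+ m) 0 coprime-1
toℚ-mkℚ m = normalize-coprime coprime-1

toℚ-+ : ∀ a b → toℚ (a ℕ.+ b) ≡ toℚ a + toℚ b
toℚ-+ a b = trans (cong (_/ 1) (sym (cong₂ ℤ._+_ (ℤ.*-identityʳ (+ a)) (ℤ.*-identityʳ (+ b)))))
                  (sym (cong₂ _+_ (toℚ-mkℚ a) (toℚ-mkℚ b)))

toℚ-* : ∀ a b → toℚ (a ℕ.* b) ≡ toℚ a * toℚ b
toℚ-* a b = trans (cong (_/ 1) (ℤ.pos-* a b)) (sym (cong₂ _*_ (toℚ-mkℚ a) (toℚ-mkℚ b)))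

toℚ-inverse : ∀ m .{{_ : NonZero m}} → toℚ m * ((+ 1) / m) ≡ 1ℚ
toℚ-inverse (suc d) = trans (cong₂ _*_ (toℚ-mkℚ (suc d)) (normalize-coprime (∣1⇒≡1 ∘ proj₁)))
                            (*-inverseʳ (mkℚ (+ suc d) 0 coprime-1))

sumTo-cong : ∀ n {f g : ℕ → ℚ} → (∀ k → f k ≡ g k) → sumTo n f ≡ sumTo n g
sumTo-cong zero    f≗g = f≗g 0
sumTo-cong (suc n) f≗g = cong₂ _+_ (sumTo-cong n f≗g) (f≗g (suc n))

sumTo-truncate : ∀ m (f : ℕ → ℚ) → (∀ j → f (3 ℕ.+ j) ≡ 0ℚ) → sumTo (2 ℕ.+ m) f ≡ sumTo 2 f
sumTo-truncate zero    f f≡0 = refl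
sumTo-truncate (suc m) f f≡0 = trans (cong₂ _+_ (sumTo-truncate m f f≡0) (f≡0 m)) (+-identityʳ (sumTo 2 f))

*-distribˡ-sumTo : ∀ n c (f : ℕ → ℚ) → c * sumTo n f ≡ sumTo n (λ k → c * f k)
*-distribˡ-sumTo zero    c f = refl
*-distribˡ-sumTo (suc n) c f = trans (*-distribˡ-+ c (sumTo n f) (f (suc n))) (cong (_+ c * f (suc n)) (*-distribˡ-sumTo n c f))

toℚ-sumUpTo : ∀ n (g : ℕ → ℕ) → toℚ (sumUpTo n g) ≡ sumTo n (λ k → toℚ (g k))
toℚ-sumUpTo zero    g = refl
toℚ-sumUpTo (suc n) g = trans (toℚ-+ (sumUpTo n g) (g (suc n))) (cong (_+ toℚ (g (suc n))) (toℚ-sumUpTo n g))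

powPS-coeff : ∀ k n → (t+t² ^PS k) n ≡ toℚ (powCoeff k n)
powPS-coeff zero    zero                = refl
powPS-coeff zero    (suc n)             = refl
powPS-coeff (suc k) zero                = *-zeroˡ ((t+t² ^PS k) 0)
powPS-coeff (suc k) (suc zero)          =
  trans (cong₂ _+_ (*-zeroˡ ((t+t² ^PS k) 1)) (*-identityˡ ((t+t² ^PS k) 0)))
        (trans (+-identityˡ ((t+t² ^PS k) 0)) (powPS-coeff k 0))
powPS-coeff (suc k) (suc (suc n))       = begin
  sumTo (2 ℕ.+ n) (λ i → t+t² i * P (2 ℕ.+ n ∸ i))
    ≡⟨ sumTo-truncate n _ (λ j → *-zeroˡ (P (2 ℕ.+ n ∸ (3 ℕ.+ j)))) ⟩
  (0ℚ * P (2 ℕ.+ n) + 1ℚ * P (suc n)) + 1ℚ * P n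
    ≡⟨ cong₂ _+_ (trans (cong₂ _+_ (*-zeroˡ (P (2 ℕ.+ n))) (*-identityˡ (P (suc n)))) (+-identityˡ (P (suc n))))
                 (*-identityˡ (P n)) ⟩
  P (suc n) + P n
    ≡⟨ cong₂ _+_ (powPS-coeff k (suc n)) (powPS-coeff k n) ⟩
  toℚ (powCoeff k (suc n)) + toℚ (powCoeff k n)
    ≡⟨ toℚ-+ (powCoeff k (suc n)) (powCoeff k n) ⟨
  toℚ (powCoeff k (suc n) ℕ.+ powCoeff k n)
    ∎
  where
  open ≡-Reasoning
  P = t+t² ^PS k

toℚ-expTerm : ∀ k n → toℚ (expTerm k n) ≡ toℚ (n !) * (1/ k ! * (t+t² ^PS k) n)
toℚ-expTerm k n = begin
  toℚ (expTerm k n)                          ≡⟨ *-identityʳ (toℚ (expTerm k n)) ⟨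
  toℚ (expTerm k n) * 1ℚ                     ≡⟨ cong (toℚ (expTerm k n) *_) (toℚ-inverse (k !) {{k !≢0}}) ⟨
  toℚ (expTerm k n) * (toℚ (k !) * 1/ k !)   ≡⟨ *-assoc (toℚ (expTerm k n)) (toℚ (k !)) (1/ k !) ⟨
  (toℚ (expTerm k n) * toℚ (k !)) * 1/ k !   ≡⟨ cong (_* 1/ k !) (toℚ-* (expTerm k n) (k !)) ⟨
  toℚ (expTerm k n ℕ.* k !) * 1/ k !         ≡⟨ cong (λ z → toℚ z * 1/ k !) (expTerm-factorial k n) ⟩
  toℚ (n ! ℕ.* powCoeff k n) * 1/ k !        ≡⟨ cong (_* 1/ k !) (toℚ-* (n !) (powCoeff k n)) ⟩
  (toℚ (n !) * toℚ (powCoeff k n)) * 1/ k !  ≡⟨ *-assoc (toℚ (n !)) (toℚ (powCoeff k n)) (1/ k !) ⟩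
  toℚ (n !) * (toℚ (powCoeff k n) * 1/ k !)  ≡⟨ cong (toℚ (n !) *_) (*-comm (toℚ (powCoeff k n)) (1/ k !)) ⟩
  toℚ (n !) * (1/ k ! * toℚ (powCoeff k n))  ≡⟨ cong (λ z → toℚ (n !) * (1/ k ! * z)) (powPS-coeff k n) ⟨
  toℚ (n !) * (1/ k ! * (t+t² ^PS k) n)      ∎
  where open ≡-Reasoning

bsm≡expCoeff : ∀ n → bsm n ≡ expCoeff n
bsm≡expCoeff = recurrence-unique (λ n → 2 ℕ.+ 2 ℕ.* n) refl refl bsm-recurrence expCoeff-recurrence

proposition2p1 : ∀ (n : ℕ) → (+ bsm n) / 1 ≡ ((+ (n !)) / 1) * expPS t+t² n
proposition2p1 n = begin
  toℚ (bsm n)                                            ≡⟨ cong toℚ (bsm≡expCoeff n) ⟩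
  toℚ (expCoeff n)                                       ≡⟨ toℚ-sumUpTo n (λ k → expTerm k n) ⟩
  sumTo n (λ k → toℚ (expTerm k n))                      ≡⟨ sumTo-cong n (λ k → toℚ-expTerm k n) ⟩
  sumTo n (λ k → toℚ (n !) * (1/ k ! * (t+t² ^PS k) n))  ≡⟨ *-distribˡ-sumTo n (toℚ (n !)) _ ⟨
  toℚ (n !) * expPS t+t² n                               ∎
  where open ≡-Reasoning
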